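{- Let $\mathcal{G}=(V,A)$ be a finite directed connected multigraph without loops on $V=[n]$, and fix orderings of the lists $\mathcal{N}(v)$ ($v\in\{0\}\cup[n]$) as described in the context. For every function $\mathbf{a}\colon[n]\to\mathbb{N}_0$, $\mathbf{a}$ fits $\mathcal{G}$ if and only if $\mathbf{a}$ is a $\mathcal{G}$-parking function.
   Context: A function $\mathbf{a}\colon[n]\to\mathbb{N}_0$ is a $\mathcal{G}$-parking function if for every nonempty $I\subseteq[n]$ there is $i\in I$ such that the number of arcs $(i,j)\in A$ with $j\notin I$, counted with multiplicity, is at least $\mathbf{a}(i)$. Let $\overline{\mathcal{G}}$ be the directed multigraph on $\{0\}\cup[n]$ whose arcs are $(0,i)$ for each $i\in[n]$ (once each) together with an arc $(j,i)$ for each arc $(i,j)\in A$ (with the same multiplicity). For each vertex $v$ of $\overline{\mathcal{G}}$, $\mathcal{N}(v)$ is a list obtained by ordering, in some fixed way, the multiset $\{i\in[n]:(v,i)\text{ is an arc of }\overline{\mathcal{G}}\}$ (with multiplicity). The DFS-burning algorithm on input $\mathbf{a}$ works with a mutable copy of $\mathbf{a}$: initially the set of burnt vertices is $\{0\}$; then it calls the recursive procedure DFS$(0)$, where DFS$(i)$ runs through $j$ in $\mathcal{N}(i)$ in order and, for each such $j$ that is not (yet) burnt: if the current value $\mathbf{a}(j)=0$, it records $(i,j)$ as a tree edge, burns $j$, and calls DFS$(j)$ (before continuing with the next element of $\mathcal{N}(i)$); otherwise it records $(i,j)$ as a dampened edge and decreases $\mathbf{a}(j)$ by $1$. The algorithm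 terminates; $\mathbf{a}$ is said to fit $\mathcal{G}$ if at termination all vertices $0,1,\dots,n$ are burnt. -}

module Defs where

open import Data.Nat using (ℕ; zero; suc; _≤_; _<_)
open import Data.Fin using (Fin; _≟_) renaming (zero to fzero; suc to fsuc)
open import Data.Fin.Subset using (Subset; _∈_; _∉_; Nonempty)
open import Data.Vec using (lookup)
open import Data.Nat.ListAction using (sum)
open import Data.List using (List; []; _∷_; map; allFin; filter; length)
open import Data.Bool using (Bool; true; false; if_then_else_)
open import Data.Product using (Σ; ∃; _×_; _,_)
open import Data.Sum using (_⊎_)
open import Relation.Binary.PropositionalEquality using (_≡_)
open import Relation.Binary.Construct.Closure.ReflexiveTransitive using (Star)
open import Relation.Nullary using (Dec; yes; no)

-- A finite directed multigraph on [n] = Fin n, given by arc multiplicities: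
-- mult i j = number of arcs (i , j) in A.
Multigraph : ℕ → Set
Multigraph n = Fin n → Fin n → ℕ

Loopless : ∀ {n} → Multigraph n → Set
Loopless {n} G = ∀ (i : Fin n) → G i i ≡ 0

Adjacent : ∀ {n} → Multigraph n → Fin n → Fin n → Set
Adjacent G i j = (0 < G i j) ⊎ (0 < G j i)

Connected : ∀ {n} → Multigraph n → Set
Connected {n} G = ∀ (i j : Fin n) → Star (Adjacent G) i j

count : ∀ {n} → Fin n → List (Fin n) → ℕ
count x l = length (filter (λ y → y ≟ x) l)

-- Vertices of Ḡ are Fin (suc n): fzero is the vertex 0, fsuc i is i ∈ [n].
-- N v is a list of elements of [n].  It is a valid ordering of the
-- out-neighbour multiset of v in Ḡ:
--   N(0) contains each i ∈ [n] exactly once;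
--   N(j) contains i with multiplicity = #arcs (i , j) in A  (arc (j , i) of Ḡ).
ValidOrdering : ∀ {n} → Multigraph n → (Fin (suc n) → List (Fin n)) → Set
ValidOrdering {n} G N =
  (∀ (i : Fin n) → count i (N fzero) ≡ 1) ×
  (∀ (j i : Fin n) → count i (N (fsuc j)) ≡ G i j)

outTo : ∀ {n} → Multigraph n → Subset n → Fin n → ℕ
outTo {n} G I i = sum (map (λ j → if lookup I j then 0 else G i j) (allFin n))

IsParking : ∀ {n} → Multigraph n → (Fin n → ℕ) → Set
IsParking {n} G a =
  ∀ (I : Subset n) → Nonempty I → Σ (Fin n) λ i → i ∈ I × a i ≤ outTo G I i

-- State of the DFS-burning algorithm: current (mutable) values of a,
-- and the burnt-flag of each vertex of [n] (vertex 0 is always burnt).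
record State (n : ℕ) : Set where
  constructor st
  field
    val   : Fin n → ℕ
    burnt : Fin n → Bool
open State public

update : ∀ {n} {A : Set} → (Fin n → A) → Fin n → A → Fin n → A
update f j x k with k ≟ j
... | yes _ = x
... | no _ = f k

-- Big-step semantics: Run N l s s' means "running through the list l
-- (the remaining part of some N(i)) inside DFS, starting in state s,
-- terminates in state s'".  DFS(v) from s ending in s' is  Run N (N v) s s'.
data Run {n : ℕ} (N : Fin (suc n) → List (Fin n)) :
         List (Fin n) → State n → State n → Set where
  done  : ∀ {s} → Run N [] s s
  skip  : ∀ {j l s s'} → burnt s j ≡ true →
          Run N l s s' → Run N (j ∷ l) s s'
  damp  : ∀ {j l s s' k} → burnt s j ≡ false → val s j ≡ suc k →
          Run N l (st (update (val s) j k) (burnt s)) s' →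
          Run N (j ∷ l) s s'
  tree  : ∀ {j l s s' s''} → burnt s j ≡ false → val s j ≡ 0 →
          Run N (N (fsuc j)) (st (val s) (update (burnt s) j true)) s' →
          Run N l s' s'' →
          Run N (j ∷ l) s s''

Fits : ∀ {n} → (Fin (suc n) → List (Fin n)) → (Fin n → ℕ) → Set
Fits {n} N a = Σ (State n) λ s' →
  Run N (N fzero) (st a (λ _ → false)) s' × (∀ (j : Fin n) → burnt s' j ≡ true)

-- Every visit of the DFS to an unburnt vertex i either dampens or burns it, and i is visited once
-- from 0 and once along each arc (i , k) of G whose endpoint k has been burnt.  So a vertex that is
-- never burnt is dampened exactly 1 + #{arcs from i into burnt vertices} times; at termination the
-- set U of unburnt vertices therefore has a(i) > outTo U i for every i ∈ U, i.e. U witnesses that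
-- a is not parking.  Conversely, if a nonempty I has a(i) > outTo I i for all i ∈ I, then as long
-- as no vertex of I is burnt, each i ∈ I keeps enough budget to absorb the at most 1 + outTo I i
-- visits it can still receive, so no vertex of I ever burns.

module Submission where

open import Defs
open import Data.Nat using (ℕ; zero; suc; _+_; _≤_; _<_; s≤s⁻¹; _≤?_)
open import Data.Nat.Properties
  using (+-assoc; +-comm; +-suc; +-identityʳ; +-cancelʳ-≡; +-monoˡ-≤; +-monoʳ-≤; m≤m+n; m≤n+m;
         n≤1+n; n<1+n; ≤-refl; ≤-reflexive; ≤-trans; <-trans; <-≤-trans; ≤-<-trans; <⇒≤; <⇒≱; ≰⇒>;
         +-commutativeSemigroup; module ≤-Reasoning)
open import Algebra.Properties.CommutativeSemigroup +-commutativeSemigroup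
  using (xy∙z≈zy∙x; xy∙z≈xz∙y; x∙yz≈xz∙y)
open import Data.Fin using (Fin; _≟_) renaming (zero to fzero; suc to fsuc)
open import Data.Fin.Subset using (Subset; _∈_)
open import Data.Fin.Subset.Properties using (_∈?_)
open import Data.Fin.Properties using (any?; suc-injective)
open import Data.Vec using (lookup; tabulate)
open import Data.Vec.Properties using ([]=⇒lookup; lookup⇒[]=; lookup∘tabulate)
open import Data.List using (List; []; _∷_; map; allFin)
open import Data.List.Properties using (map-tabulate)
open import Data.Nat.ListAction using (sum)
open import Data.Bool using (Bool; true; false; if_then_else_; not)
open import Data.Bool.Properties using (¬-not; not-involutive)
open import Data.Product using (∃; _×_; _,_; proj₁; proj₂; map₂)
open import Data.Empty using (⊥-elim)
open import Function using (_∘_; id)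
open import Function.Bundles using (_⇔_; mk⇔)
open import Relation.Binary.PropositionalEquality
open import Relation.Nullary using (yes; no)
open import Relation.Nullary.Decidable using (_×-dec_)

sumFin : ∀ {n} → (Fin n → ℕ) → ℕ
sumFin {n} f = sum (map f (allFin n))

sumFin-suc : ∀ {n} (f : Fin (suc n) → ℕ) → sumFin f ≡ f fzero + sumFin (f ∘ fsuc)
sumFin-suc f = cong (λ xs → f fzero + sum xs)
  (trans (map-tabulate fsuc f) (sym (map-tabulate id (f ∘ fsuc))))

sumFin-cong : ∀ {n} {f g : Fin n → ℕ} → (∀ k → f k ≡ g k) → sumFin f ≡ sumFin g
sumFin-cong {zero}          f≗g = refl
sumFin-cong {suc n} {f} {g} f≗g = begin
  sumFin f                     ≡⟨ sumFin-suc f ⟩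
  f fzero + sumFin (f ∘ fsuc)  ≡⟨ cong₂ _+_ (f≗g fzero) (sumFin-cong (f≗g ∘ fsuc)) ⟩
  g fzero + sumFin (g ∘ fsuc)  ≡⟨ sym (sumFin-suc g) ⟩
  sumFin g                     ∎
  where open ≡-Reasoning

sumFin-zero : ∀ {n} → sumFin {n} (λ _ → 0) ≡ 0
sumFin-zero {zero}  = refl
sumFin-zero {suc n} = trans (sumFin-suc {n} (λ _ → 0)) (sumFin-zero {n})

sumFin-agree-except : ∀ {n} (f g : Fin n → ℕ) j → (∀ k → k ≢ j → f k ≡ g k) →
  sumFin f + g j ≡ sumFin g + f j
sumFin-agree-except {suc n} f g fzero f≗g = begin
  sumFin f + g fzero                     ≡⟨ cong (_+ g fzero) (sumFin-suc f) ⟩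
  f fzero + sumFin (f ∘ fsuc) + g fzero  ≡⟨ cong (λ t → f fzero + t + g fzero) tails ⟩
  f fzero + sumFin (g ∘ fsuc) + g fzero  ≡⟨ xy∙z≈zy∙x (f fzero) _ (g fzero) ⟩
  g fzero + sumFin (g ∘ fsuc) + f fzero  ≡⟨ cong (_+ f fzero) (sym (sumFin-suc g)) ⟩
  sumFin g + f fzero                     ∎
  where
  open ≡-Reasoning
  tails : sumFin (f ∘ fsuc) ≡ sumFin (g ∘ fsuc)
  tails = sumFin-cong (λ k → f≗g (fsuc k) λ ())
sumFin-agree-except {suc n} f g (fsuc j) f≗g = begin
  sumFin f + g (fsuc j)                       ≡⟨ cong (_+ g (fsuc j)) (sumFin-suc f) ⟩
  f fzero + sumFin (f ∘ fsuc) + g (fsuc j)    ≡⟨ +-assoc (f fzero) _ _ ⟩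
  f fzero + (sumFin (f ∘ fsuc) + g (fsuc j))  ≡⟨ cong₂ _+_ (f≗g fzero λ ()) tails ⟩
  g fzero + (sumFin (g ∘ fsuc) + f (fsuc j))  ≡⟨ sym (+-assoc (g fzero) _ _) ⟩
  g fzero + sumFin (g ∘ fsuc) + f (fsuc j)    ≡⟨ cong (_+ f (fsuc j)) (sym (sumFin-suc g)) ⟩
  sumFin g + f (fsuc j)                       ∎
  where
  open ≡-Reasoning
  tails : sumFin (f ∘ fsuc) + g (fsuc j) ≡ sumFin (g ∘ fsuc) + f (fsuc j)
  tails = sumFin-agree-except (f ∘ fsuc) (g ∘ fsuc) j (λ k k≢j → f≗g (fsuc k) (k≢j ∘ suc-injective))

update-same : ∀ {n} {A : Set} (f : Fin n → A) j x → update f j x j ≡ x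
update-same f j x with j ≟ j
... | yes _   = refl
... | no j≢j = ⊥-elim (j≢j refl)

update-other : ∀ {n} {A : Set} (f : Fin n → A) j x {k} → k ≢ j → update f j x k ≡ f k
update-other f j x {k} k≢j with k ≟ j
... | yes k≡j = ⊥-elim (k≢j k≡j)
... | no _    = refl

update-keeps : ∀ {n} {A : Set} (f : Fin n → A) j x {k} → f k ≡ x → update f j x k ≡ x
update-keeps f j x {k} fk≡x with k ≟ j
... | yes _ = refl
... | no _  = fk≡x

sumFin-update : ∀ {n} {A : Set} (h : Fin n → A → ℕ) (b : Fin n → A) j x →
  sumFin (λ k → h k (update b j x k)) + h j (b j) ≡ sumFin (λ k → h k (b k)) + h j x
sumFin-update h b j x =
  trans (sumFin-agree-except _ _ j (λ k k≢j → cong (h k) (update-other b j x k≢j)))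
        (cong (λ y → sumFin (λ k → h k (b k)) + h j y) (update-same b j x))

count-here : ∀ {n} (x : Fin n) l → count x (x ∷ l) ≡ suc (count x l)
count-here x l with x ≟ x
... | yes _   = refl
... | no x≢x = ⊥-elim (x≢x refl)

count-there : ∀ {n} {x y : Fin n} l → y ≢ x → count x (y ∷ l) ≡ count x l
count-there {x = x} {y} l y≢x with y ≟ x
... | yes y≡x = ⊥-elim (y≢x y≡x)
... | no _    = refl

count-≤-cons : ∀ {n} (x y : Fin n) l → count x l ≤ count x (y ∷ l)
count-≤-cons x y l with y ≟ x
... | yes _ = n≤1+n _
... | no _  = ≤-refl

true≢false : true ≢ false
true≢false ()

≢-by-flag : ∀ {n} {b : Fin n → Bool} {i j} → b i ≡ true → b j ≡ false → i ≢ j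
≢-by-flag bi bj refl = true≢false (trans (sym bi) bj)

module DFS {n : ℕ} (G : Multigraph n) (N : Fin (suc n) → List (Fin n)) (valid : ValidOrdering G N) where

  N-root : ∀ i → count i (N fzero) ≡ 1
  N-root = proj₁ valid

  N-arcs : ∀ j i → count i (N (fsuc j)) ≡ G i j
  N-arcs = proj₂ valid

  run-keeps-burnt : ∀ {l s s' k} → Run N l s s' → burnt s k ≡ true → burnt s' k ≡ true
  run-keeps-burnt done         bk = bk
  run-keeps-burnt (skip _ r)   bk = run-keeps-burnt r bk
  run-keeps-burnt (damp _ _ r) bk = run-keeps-burnt r bk
  run-keeps-burnt {s = s} (tree {j = j} _ _ r₁ r₂) bk =
    run-keeps-burnt r₂ (run-keeps-burnt r₁ (update-keeps (burnt s) j true bk))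

  run-unburnt-before : ∀ {l s s' k} → Run N l s s' → burnt s' k ≡ false → burnt s k ≡ false
  run-unburnt-before r b'k = ¬-not λ bk → true≢false (trans (sym (run-keeps-burnt r bk)) b'k)

  unburnt : (Fin n → Bool) → ℕ
  unburnt b = sumFin (λ k → if b k then 0 else 1)

  unburnt-burn : ∀ {b j} → b j ≡ false → unburnt (update b j true) < unburnt b
  unburnt-burn {b} {j} bj = ≤-reflexive (begin
    suc (unburnt b')                     ≡⟨ +-comm 1 (unburnt b') ⟩
    unburnt b' + 1                       ≡⟨ cong (λ x → unburnt b' + (if x then 0 else 1)) (sym bj) ⟩
    unburnt b' + (if b j then 0 else 1)  ≡⟨ sumFin-update (λ _ x → if x then 0 else 1) b j true ⟩
    unburnt b + 0                        ≡⟨ +-identityʳ _ ⟩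
    unburnt b                            ∎)
    where
    open ≡-Reasoning
    b' : Fin n → Bool
    b' = update b j true

  run-unburnt-antitone : ∀ {l s s'} → Run N l s s' → unburnt (burnt s') ≤ unburnt (burnt s)
  run-unburnt-antitone done            = ≤-refl
  run-unburnt-antitone (skip _ r)      = run-unburnt-antitone r
  run-unburnt-antitone (damp _ _ r)    = run-unburnt-antitone r
  run-unburnt-antitone (tree bj _ r₁ r₂) =
    ≤-trans (run-unburnt-antitone r₂) (≤-trans (run-unburnt-antitone r₁) (<⇒≤ (unburnt-burn bj)))

  run-exists : ∀ k s → unburnt (burnt s) < k → ∀ l → ∃ (Run N l s)
  run-burning : ∀ k s j l → burnt s j ≡ false → val s j ≡ 0 → unburnt (burnt s) < k →
    ∃ (Run N (j ∷ l) s)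

  run-exists k s _ [] = s , done
  run-exists k s u<k (j ∷ l) with burnt s j in bj
  ... | true = map₂ (skip bj) (run-exists k s u<k l)
  ... | false with val s j in vj
  ...   | suc m = map₂ (damp bj vj) (run-exists k (st (update (val s) j m) (burnt s)) u<k l)
  ...   | zero  = run-burning k s j l bj vj u<k

  run-burning (suc k) s j l bj vj u<k =
    let s₁ = st (val s) (update (burnt s) j true)
        (s₂ , r₁) = run-exists k s₁ (<-≤-trans (unburnt-burn bj) (s≤s⁻¹ u<k)) (N (fsuc j))
        (s₃ , r₂) = run-exists (suc k) s₂
                      (≤-<-trans (run-unburnt-antitone r₁) (<-trans (unburnt-burn bj) u<k)) l
    in s₃ , tree bj vj r₁ r₂

  arcsToBurnt : (Fin n → Bool) → Fin n → ℕ
  arcsToBurnt b i = sumFin (λ k → if b k then G i k else 0)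

  arcsToBurnt-burn : ∀ {b j} i → b j ≡ false →
    arcsToBurnt (update b j true) i ≡ arcsToBurnt b i + G i j
  arcsToBurnt-burn {b} {j} i bj = begin
    arcsToBurnt b' i                               ≡⟨ sym (+-identityʳ _) ⟩
    arcsToBurnt b' i + 0                           ≡⟨ cong (λ x → arcsToBurnt b' i + (if x then G i j else 0)) (sym bj) ⟩
    arcsToBurnt b' i + (if b j then G i j else 0)  ≡⟨ sumFin-update (λ k x → if x then G i k else 0) b j true ⟩
    arcsToBurnt b i + G i j                        ∎
    where
    open ≡-Reasoning
    b' : Fin n → Bool
    b' = update b j true

  run-unburnt-balance : ∀ {l s s' i} → Run N l s s' → burnt s' i ≡ false →
    val s' i + count i l + arcsToBurnt (burnt s') i ≡ val s i + arcsToBurnt (burnt s) i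
  run-unburnt-balance {s = s} {i = i} done _ =
    cong (_+ arcsToBurnt (burnt s) i) (+-identityʳ (val s i))
  run-unburnt-balance {j ∷ l} {s} {s'} {i} (skip bj r) b'i =
    trans (cong (λ c → val s' i + c + arcsToBurnt (burnt s') i)
                (count-there l (≢-by-flag {b = burnt s} bj (run-unburnt-before r b'i))))
          (run-unburnt-balance r b'i)
  run-unburnt-balance {j ∷ l} {s} {s'} {i} (damp {k = m} _ vj r) b'i with i ≟ j
  ... | yes refl = begin
    val s' i + count i (i ∷ l) + B'  ≡⟨ cong (λ c → val s' i + c + B') (count-here i l) ⟩
    val s' i + suc (count i l) + B'  ≡⟨ cong (_+ B') (+-suc (val s' i) _) ⟩
    suc (val s' i + count i l + B')  ≡⟨ cong suc (run-unburnt-balance r b'i) ⟩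
    suc (update (val s) i m i + B)   ≡⟨ cong (λ v → suc (v + B)) (update-same (val s) i m) ⟩
    suc (m + B)                      ≡⟨ cong (_+ B) (sym vj) ⟩
    val s i + B                      ∎
    where
    open ≡-Reasoning
    B B' : ℕ
    B = arcsToBurnt (burnt s) i
    B' = arcsToBurnt (burnt s') i
  ... | no i≢j =
    trans (cong (λ c → val s' i + c + arcsToBurnt (burnt s') i) (count-there l (i≢j ∘ sym)))
          (trans (run-unburnt-balance r b'i)
                 (cong (_+ arcsToBurnt (burnt s) i) (update-other (val s) j m i≢j)))
  run-unburnt-balance {j ∷ l} {s} {s₃} {i} (tree {s' = s₂} bj _ r₁ r₂) b₃i =
    +-cancelʳ-≡ (G i j) _ _ (begin
      val s₃ i + count i (j ∷ l) + B₃ + G i j  ≡⟨ cong (λ c → val s₃ i + c + B₃ + G i j) (count-there l j≢i) ⟩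
      val s₃ i + count i l + B₃ + G i j        ≡⟨ cong (_+ G i j) (run-unburnt-balance r₂ b₃i) ⟩
      val s₂ i + B₂ + G i j                    ≡⟨ xy∙z≈xz∙y (val s₂ i) B₂ (G i j) ⟩
      val s₂ i + G i j + B₂                    ≡⟨ cong (λ c → val s₂ i + c + B₂) (sym (N-arcs j i)) ⟩
      val s₂ i + count i (N (fsuc j)) + B₂     ≡⟨ run-unburnt-balance r₁ b₂i ⟩
      val s i + arcsToBurnt (update (burnt s) j true) i ≡⟨ cong (val s i +_) (arcsToBurnt-burn i bj) ⟩
      val s i + (B + G i j)  ≡⟨ sym (+-assoc (val s i) B (G i j)) ⟩
      val s i + B + G i j    ∎)
    where
    open ≡-Reasoning
    B B₂ B₃ : ℕ
    B = arcsToBurnt (burnt s) i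
    B₂ = arcsToBurnt (burnt s₂) i
    B₃ = arcsToBurnt (burnt s₃) i
    b₂i : burnt s₂ i ≡ false
    b₂i = run-unburnt-before r₂ b₃i
    j≢i : j ≢ i
    j≢i = ≢-by-flag (update-same (burnt s) j true) (run-unburnt-before r₁ b₂i)

  unburnt⇒arcsToBurnt< : ∀ {a s' i} → Run N (N fzero) (st a (λ _ → false)) s' → burnt s' i ≡ false →
    arcsToBurnt (burnt s') i < a i
  unburnt⇒arcsToBurnt< {a} {s'} {i} r b'i = begin-strict
    B'                                 <⟨ n<1+n B' ⟩
    1 + B'                             ≤⟨ m≤n+m (1 + B') (val s' i) ⟩
    val s' i + (1 + B')                ≡⟨ sym (+-assoc (val s' i) 1 B') ⟩
    val s' i + 1 + B'                  ≡⟨ cong (λ c → val s' i + c + B') (sym (N-root i)) ⟩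
    val s' i + count i (N fzero) + B'  ≡⟨ run-unburnt-balance r b'i ⟩
    a i + arcsToBurnt (λ _ → false) i  ≡⟨ cong (a i +_) (sumFin-zero {n}) ⟩
    a i + 0                            ≡⟨ +-identityʳ (a i) ⟩
    a i                                ∎
    where
    open ≤-Reasoning
    B' : ℕ
    B' = arcsToBurnt (burnt s') i

  unburntSet : (Fin n → Bool) → Subset n
  unburntSet b = tabulate (not ∘ b)

  ∈-unburntSet : ∀ {b j} → b j ≡ false → j ∈ unburntSet b
  ∈-unburntSet {b} {j} bj =
    lookup⇒[]= j (unburntSet b) (trans (lookup∘tabulate (not ∘ b) j) (cong not bj))

  ∈-unburntSet⁻ : ∀ {b j} → j ∈ unburntSet b → b j ≡ false
  ∈-unburntSet⁻ {b} {j} j∈U =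
    trans (sym (not-involutive (b j)))
          (cong not (trans (sym (lookup∘tabulate (not ∘ b) j)) ([]=⇒lookup j∈U)))

  outTo-unburntSet : ∀ b i → outTo G (unburntSet b) i ≡ arcsToBurnt b i
  outTo-unburntSet b i = sumFin-cong pointwise
    where
    pointwise : ∀ k → (if lookup (unburntSet b) k then 0 else G i k) ≡ (if b k then G i k else 0)
    pointwise k rewrite lookup∘tabulate (not ∘ b) k with b k
    ... | true  = refl
    ... | false = refl

  module Guard (I : Subset n) where

    arcsLeavingToUnburnt : (Fin n → Bool) → Fin n → ℕ
    arcsLeavingToUnburnt b i = sumFin (λ k → if lookup I k then 0 else if b k then 0 else G i k)

    arcsLeavingToUnburnt-burn : ∀ {b j} i → lookup I j ≡ false → b j ≡ false →
      arcsLeavingToUnburnt b i ≡ arcsLeavingToUnburnt (update b j true) i + G i j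
    arcsLeavingToUnburnt-burn {b} {j} i Ij bj = sym (begin
      W b' + G i j                   ≡⟨ cong₂ (λ y x → W b' + h j y x) (sym Ij) (sym bj) ⟩
      W b' + h j (lookup I j) (b j)  ≡⟨ sumFin-update (λ k → h k (lookup I k)) b j true ⟩
      W b + h j (lookup I j) true    ≡⟨ cong (λ y → W b + h j y true) Ij ⟩
      W b + 0                        ≡⟨ +-identityʳ _ ⟩
      W b                            ∎)
      where
      open ≡-Reasoning
      W : (Fin n → Bool) → ℕ
      W b = arcsLeavingToUnburnt b i
      b' : Fin n → Bool
      b' = update b j true
      h : Fin n → Bool → Bool → ℕ
      h k y x = if y then 0 else if x then 0 else G i k

    -- pending i counts the visits i is still due: those from the list being run and from the
    -- lists suspended further down the DFS stack.
    Guarded : (Fin n → ℕ) → State n → Set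
    Guarded pending s =
      ∀ i → i ∈ I → burnt s i ≡ false × pending i + arcsLeavingToUnburnt (burnt s) i ≤ val s i

    guarded-weaken : ∀ {p q s} → (∀ i → p i ≤ q i) → Guarded q s → Guarded p s
    guarded-weaken p≤q g i i∈I = proj₁ (g i i∈I) , ≤-trans (+-monoˡ-≤ _ (p≤q i)) (proj₂ (g i i∈I))

    pending-here : ∀ (d : Fin n → ℕ) i l w → d i + count i (i ∷ l) + w ≡ suc (d i + count i l + w)
    pending-here d i l w =
      trans (cong (λ c → d i + c + w) (count-here i l)) (cong (_+ w) (+-suc (d i) _))

    run-guarded : ∀ {l s s'} (d : Fin n → ℕ) → Run N l s s' →
      Guarded (λ i → d i + count i l) s → Guarded d s'
    run-guarded d done g = guarded-weaken (λ i → m≤m+n (d i) 0) g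
    run-guarded d (skip {j} {l} _ r) g =
      run-guarded d r (guarded-weaken (λ i → +-monoʳ-≤ (d i) (count-≤-cons i j l)) g)
    run-guarded d (damp {j} {l} {s} {k = m} _ vj r) g = run-guarded d r dampened
      where
      dampened : Guarded (λ i → d i + count i l) (st (update (val s) j m) (burnt s))
      -- abstracting over i ≟ j also evaluates update (val s) j m i
      dampened i i∈I with i ≟ j | g i i∈I
      ... | yes refl | bi , le = bi ,
        s≤s⁻¹ (subst₂ _≤_ (pending-here d i l _) vj le)
      ... | no i≢j   | bi , le = bi ,
        ≤-trans (+-monoˡ-≤ _ (+-monoʳ-≤ (d i) (count-≤-cons i j l))) le
    run-guarded d (tree {j} {l} {s} bj vj r₁ r₂) g with lookup I j in Ij
    ... | true with () ← subst₂ _≤_ (pending-here d j l _) vj (proj₂ (g j (lookup⇒[]= j I Ij)))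
    ... | false = run-guarded d r₂ (run-guarded (λ i → d i + count i l) r₁ burning)
      where
      W : (Fin n → Bool) → Fin n → ℕ
      W = arcsLeavingToUnburnt
      burning : Guarded (λ i → d i + count i l + count i (N (fsuc j)))
                        (st (val s) (update (burnt s) j true))
      burning i i∈I =
        trans (update-other (burnt s) j true i≢j) (proj₁ (g i i∈I)) ,
        subst (_≤ val s i) moved (proj₂ (g i i∈I))
        where
        open ≡-Reasoning
        i≢j : i ≢ j
        i≢j refl = true≢false (trans (sym ([]=⇒lookup i∈I)) Ij)
        moved : d i + count i (j ∷ l) + W (burnt s) i
              ≡ d i + count i l + count i (N (fsuc j)) + W (update (burnt s) j true) i
        moved = begin
          d i + count i (j ∷ l) + W (burnt s) i
            ≡⟨ cong₂ (λ c w → d i + c + w) (count-there l (i≢j ∘ sym)) (arcsLeavingToUnburnt-burn i Ij bj) ⟩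
          d i + count i l + (W (update (burnt s) j true) i + G i j)
            ≡⟨ x∙yz≈xz∙y (d i + count i l) _ (G i j) ⟩
          d i + count i l + G i j + W (update (burnt s) j true) i
            ≡⟨ cong (λ c → d i + count i l + c + W (update (burnt s) j true) i) (sym (N-arcs j i)) ⟩
          d i + count i l + count i (N (fsuc j)) + W (update (burnt s) j true) i ∎

    nonparking-never-burnt : ∀ {a s'} → Run N (N fzero) (st a (λ _ → false)) s' →
      (∀ i → i ∈ I → outTo G I i < a i) → ∀ i → i ∈ I → burnt s' i ≡ false
    nonparking-never-burnt {a} r overbudget i i∈I = proj₁ (run-guarded (λ _ → 0) r initial i i∈I)
      where
      initial : Guarded (λ i → count i (N fzero)) (st a (λ _ → false))
      initial i i∈I = refl , subst (λ c → c + outTo G I i ≤ a i) (sym (N-root i)) (overbudget i i∈I)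

proposition3p2 : (n : ℕ) (G : Multigraph n) → Loopless G → Connected G →
    (N : Fin (suc n) → List (Fin n)) → ValidOrdering G N →
    (a : Fin n → ℕ) → Fits N a ⇔ IsParking G a
proposition3p2 n G _ _ N valid a = mk⇔ fits⇒parking parking⇒fits
  where
  open DFS G N valid

  fits⇒parking : Fits N a → IsParking G a
  fits⇒parking (s' , r , allBurnt) I (x , x∈I) with any? (λ i → i ∈? I ×-dec a i ≤? outTo G I i)
  ... | yes parkingVertex = parkingVertex
  ... | no none = ⊥-elim (true≢false (trans (sym (allBurnt x)) (never-burnt x x∈I)))
    where
    never-burnt : ∀ i → i ∈ I → burnt s' i ≡ false
    never-burnt = Guard.nonparking-never-burnt I r (λ i i∈I → ≰⇒> λ ai≤ → none (i , i∈I , ai≤))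

  parking⇒fits : IsParking G a → Fits N a
  parking⇒fits parking = proj₁ run , proj₂ run , allBurnt
    where
    run : ∃ (Run N (N fzero) (st a (λ _ → false)))
    run = run-exists _ (st a (λ _ → false)) (n<1+n _) (N fzero)
    allBurnt : ∀ j → burnt (proj₁ run) j ≡ true
    allBurnt j = ¬-not λ b'j →
      let (i , i∈U , ai≤) = parking (unburntSet (burnt (proj₁ run))) (j , ∈-unburntSet b'j)
      in <⇒≱ (unburnt⇒arcsToBurnt< (proj₂ run) (∈-unburntSet⁻ i∈U))
             (≤-trans ai≤ (≤-reflexive (outTo-unburntSet _ i)))
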